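{- Let $n\ge1$, $m\ge2$, $1\le r\le m$, let $M$ be a perfect matching of $T(2n+1,2m,2r)$ and let $C$ be an $I$-cycle. If $M\cap\nabla(C)$ contains two distinct consecutive horizontal edges on the same side of $C$, then by a sequence of flips starting from $M$ one can obtain a perfect matching $M'$ of $T(2n+1,2m,2r)$ whose number of horizontal edges is two less than that of $M$.
   Context: Write $Z_k=\{0,\dots,k-1\}$. $T(N,K,R)$ is the graph with vertices $v_{i,j}$ ($i\in Z_N$, $j\in Z_K$, second index mod $K$), horizontal edges $v_{i,j}v_{i,j+1}$ and vertical edges $v_{i,j}v_{i+1,j}$ ($0\le i\le N-2$) and $v_{N-1,j}v_{0,j+R}$, embedded on the torus with faces $v_{i,j}v_{i,j+1}v_{i+1,j+1}v_{i+1,j}$ ($0\le i\le N-2$) and $v_{N-1,j}v_{N-1,j+1}v_{0,j+R+1}v_{0,j+R}$. A flip of a perfect matching $M$ replaces $M$ by $M\oplus E(f)$ where $f$ is a face whose boundary is $M$-alternating. The vertical edges form a disjoint union of cycles, the $I$-cycles (each is a union of columns $v_{0,j}\cdots v_{N-1,j}$). In $T(2n+1,2m,2r)$ two consecutive columns lie on different $I$-cycles. $\nabla(C)$ is the set of edges with exactly one end on $C$; each such edge is horizontal, $v_{i,c}v_{i,c+1}$, and it leaves $C$ to the right if $v_{i,c}\in C$ and to the left if $v_{i,c+1}\in C$; two such edges are on the same side if both leave to the right or both to the left. Two edges $h_1,h_2\in M\cap \nabla(C)$ with ends $x_1,x_2$ on $C$ are consecutive if there is a path $P$ in $C$ from $x_1$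 to $x_2$ all of whose internal vertices are covered by edges of $M\cap E(P)$. -}

module Defs where

open import Data.Nat using (ℕ; zero; suc; _+_; _<_; _%_)
open import Data.Nat.DivMod using (m%n<n)
open import Data.Fin using (Fin; toℕ; fromℕ<; fromℕ; inject₁)
  renaming (zero to fzero; suc to fsuc)
open import Data.Fin.Properties using () renaming (_≟_ to _≟ᶠ_)
open import Data.Bool using (Bool; true; false; if_then_else_; _∧_; _xor_)
open import Data.Product using (Σ; ∃; _×_; _,_; proj₁; proj₂)
open import Data.Sum using (_⊎_)
open import Data.List using (List; map; allFin)
open import Data.Nat.ListAction using (sum)
open import Relation.Nullary using (¬_; does)
open import Relation.Binary.PropositionalEquality using (_≡_; _≢_)
open import Relation.Binary.Construct.Closure.ReflexiveTransitive using (Star)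
open import Function.Definitions using (Injective)

addMod : ∀ {K} → Fin K → ℕ → Fin K
addMod {suc k} j a = fromℕ< (m%n<n (toℕ j + a) (suc k))

data Kind : Set where
  hor ver : Kind

kind≟ : Kind → Kind → Bool
kind≟ hor hor = true
kind≟ ver ver = true
kind≟ _ _ = false

module T (N K R : ℕ) where

  Vertex : Set
  Vertex = Fin N × Fin K

  -- Edges are indexed by (kind, i, j):
  --   (hor , i , j) : v_{i,j} v_{i,j+1}
  --   (ver , i , j) : v_{i,j} v_{i+1,j}        if i ≤ N-2
  --                   v_{N-1,j} v_{0,j+R}      if i = N-1
  Edge : Set
  Edge = Kind × Fin N × Fin K

  kind : Edge → Kind
  kind = proj₁

  lastRow : Fin N → Bool
  lastRow i = does (suc (toℕ i) Data.Nat.≟ N)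

  ends : Edge → Vertex × Vertex
  ends (hor , i , j) = (i , j) , (i , addMod j 1)
  ends (ver , i , j) = (i , j) , (addMod i 1 , (if lastRow i then addMod j R else j))

  Incident : Vertex → Edge → Set
  Incident v e = v ≡ proj₁ (ends e) ⊎ v ≡ proj₂ (ends e)

  edgeEq : Edge → Edge → Bool
  edgeEq (k , i , j) (k' , i' , j') = kind≟ k k' ∧ does (i ≟ᶠ i') ∧ does (j ≟ᶠ j')

  EdgeSet : Set
  EdgeSet = Edge → Bool

  IsPerfectMatching : EdgeSet → Set
  IsPerfectMatching M =
    ∀ (v : Vertex) → Σ Edge λ e → M e ≡ true × Incident v e ×
      (∀ e' → M e' ≡ true → Incident v e' → e' ≡ e)

  -- Faces, indexed by (i , j) : the face with boundary edges
  --   h(i,j), V(i,j+1), h(i+1, j + s), V(i,j), where s = R if i = N-1, else 0.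
  Face : Set
  Face = Fin N × Fin K

  fEdge₁ fEdge₂ fEdge₃ fEdge₄ : Face → Edge
  fEdge₁ (i , j) = hor , i , j
  fEdge₂ (i , j) = ver , i , addMod j 1
  fEdge₃ (i , j) = hor , addMod i 1 , (if lastRow i then addMod j R else j)
  fEdge₄ (i , j) = ver , i , j

  inFace : Face → Edge → Bool
  inFace f e = edgeEq e (fEdge₁ f) Data.Bool.∨ edgeEq e (fEdge₂ f)
    Data.Bool.∨ edgeEq e (fEdge₃ f) Data.Bool.∨ edgeEq e (fEdge₄ f)

  Alternating : EdgeSet → Face → Set
  Alternating M f =
    (M (fEdge₁ f) ≡ true × M (fEdge₃ f) ≡ true × M (fEdge₂ f) ≡ false × M (fEdge₄ f) ≡ false)
    ⊎ (M (fEdge₂ f) ≡ true × M (fEdge₄ f) ≡ true × M (fEdge₁ f) ≡ false × M (fEdge₃ f) ≡ false)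

  Flip : EdgeSet → EdgeSet → Set
  Flip M M' = Σ Face λ f → Alternating M f × (∀ e → M' e ≡ (M e xor inFace f e))

  Flips : EdgeSet → EdgeSet → Set
  Flips = Star Flip

  hcount : EdgeSet → ℕ
  hcount M = sum (map (λ i → sum (map (λ j → if M (hor , i , j) then 1 else 0) (allFin K))) (allFin N))

  VAdj : Vertex → Vertex → Set
  VAdj a b = Σ Edge λ e → kind e ≡ ver × (ends e ≡ (a , b) ⊎ ends e ≡ (b , a))

  -- the I-cycle through x₀: the vertices reachable from x₀ along vertical edges
  ICycle : Vertex → Vertex → Set
  ICycle x₀ v = Star VAdj x₀ v

  LeavesRight : (Vertex → Set) → Edge → Set
  LeavesRight C e = C (proj₁ (ends e)) × ¬ C (proj₂ (ends e))

  LeavesLeft : (Vertex → Set) → Edge → Set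
  LeavesLeft C e = ¬ C (proj₁ (ends e)) × C (proj₂ (ends e))

  SameSide : (Vertex → Set) → Edge → Edge → Set
  SameSide C h₁ h₂ = (LeavesRight C h₁ × LeavesRight C h₂) ⊎ (LeavesLeft C h₁ × LeavesLeft C h₂)

  record CoveredPath (M : EdgeSet) (C : Vertex → Set) (x₁ x₂ : Vertex) : Set where
    field
      len : ℕ
      p : Fin (suc len) → Vertex
      es : Fin len → Edge
      start : p fzero ≡ x₁
      finish : p (fromℕ len) ≡ x₂
      distinct : Injective _≡_ _≡_ p
      inC : ∀ t → C (p t)
      step : ∀ (t : Fin len) → kind (es t) ≡ ver ×
               (ends (es t) ≡ (p (inject₁ t) , p (fsuc t)) ⊎ ends (es t) ≡ (p (fsuc t) , p (inject₁ t)))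
      covered : ∀ (t : Fin len) → 0 < toℕ t →
                  Σ (Fin len) λ u → M (es u) ≡ true × Incident (p (inject₁ t)) (es u)

  Consecutive : EdgeSet → (Vertex → Set) → Edge → Edge → Set
  Consecutive M C h₁ h₂ = Σ Vertex λ x₁ → Σ Vertex λ x₂ →
    C x₁ × Incident x₁ h₁ × C x₂ × Incident x₂ h₂ × CoveredPath M C x₁ x₂

{-# OPTIONS --safe #-}
module Submission where

-- Both edges leave C on the same side d, so the path of C joining their ends starts and ends at
-- vertices matched away from C; hence its edges alternate unmatched/matched, it has odd length
-- 2k+1, and read upwards from its lower end x it is an alternating segment: x and up^(2k+1) x are
-- matched towards d, and up^(2s+1) x to up^(2s+2) x for s < k. For k = 0 the face
-- beside x is alternating and flipping it removes two horizontal edges. Otherwise let y be the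
-- neighbour of up x on side d. If y is matched further out, climbing the neighbouring column from
-- y yields a shorter alternating segment there. If y is matched upwards, the face beside up x and
-- up² x is alternating; flipping it and then the face beside x keeps the number of horizontal
-- edges and leaves a segment of length 2k-1 starting at up² x. Throughout, vertices of
-- neighbouring columns never meet, because K and R are even and vertical moves preserve the parity
-- of the column index.

open import Defs
open import Data.Nat using (ℕ; zero; suc; _+_; _*_; _≤_; _<_; _%_; _∸_; z≤n; s≤s; s≤s⁻¹; NonZero)
import Data.Nat.Properties as ℕ
open import Data.Nat.DivMod
  using (%-distribˡ-+; m%n%n≡m%n; [m+n]%n≡m%n; m<n⇒m%n≡m; n%n≡0; m%n<n; %-remove-+ʳ; m∣n⇒o%n%m≡o%m)
open import Data.Nat.Divisibility using (_∣_; divides)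
open import Data.Fin using (Fin; toℕ; fromℕ<; inject₁) renaming (zero to fzero; suc to fsuc)
open import Data.Fin.Properties
  using (toℕ-fromℕ<; toℕ-injective; toℕ-inject₁; toℕ-fromℕ; toℕ<n; suc-injective) renaming (_≟_ to _≟ᶠ_)
open import Data.Bool using (Bool; true; false; if_then_else_; _∧_; _xor_; _∨_; not)
open import Data.Bool.Properties using (not-¬; xor-identityʳ; xor-comm; true-xor; ∨-zeroʳ)
open import Data.Product using (Σ; _×_; _,_; proj₁; proj₂)
open import Data.Product.Properties using (≡-dec)
open import Data.Sum using (_⊎_; inj₁; inj₂; [_,_])
open import Data.Empty using (⊥; ⊥-elim)
open import Relation.Nullary using (¬_; yes; no)
open import Relation.Nullary.Decidable using (dec-true)
open import Relation.Binary.PropositionalEquality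
  using (_≡_; _≢_; ≢-sym; refl; sym; trans; cong; cong₂; subst; subst₂; module ≡-Reasoning)
open import Relation.Binary.Construct.Closure.ReflexiveTransitive using (ε; _◅_; _◅◅_)
open import Data.List using (map; allFin; tabulate)
open import Data.List.Properties using (map-tabulate; tabulate-cong)
open import Data.Nat.ListAction using (sum)
open import Data.Nat.Tactic.RingSolver using (solve-∀)
open ≡-Reasoning

[m%n+o]%n≡[m+o]%n : ∀ m o n .{{_ : NonZero n}} → (m % n + o) % n ≡ (m + o) % n
[m%n+o]%n≡[m+o]%n m o n = begin
  (m % n + o) % n          ≡⟨ %-distribˡ-+ (m % n) o n ⟩
  (m % n % n + o % n) % n  ≡⟨ cong (λ t → (t + o % n) % n) (m%n%n≡m%n m n) ⟩
  (m % n + o % n) % n      ≡⟨ %-distribˡ-+ m o n ⟨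
  (m + o) % n              ∎

[m+1]%2≢m%2 : ∀ m → (m + 1) % 2 ≢ m % 2
[m+1]%2≢m%2 m eq = [r+1]%2≢r (m % 2) (m%n<n m 2) (trans ([m%n+o]%n≡[m+o]%n m 1 2) eq)
  where
  [r+1]%2≢r : ∀ r → r < 2 → (r + 1) % 2 ≢ r
  [r+1]%2≢r 0 _ ()
  [r+1]%2≢r 1 _ ()
  [r+1]%2≢r (suc (suc _)) (s≤s (s≤s ()))

∨-true : ∀ a {b} → b ≡ true → a ∨ b ≡ true
∨-true a refl = ∨-zeroʳ a

xor≡true : ∀ a b → a xor b ≡ true → (a ≡ true × b ≡ false) ⊎ (a ≡ false × b ≡ true)
xor≡true true false _ = inj₁ (refl , refl)
xor≡true false true _ = inj₂ (refl , refl)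

xor-false : ∀ a {b} → b ≡ false → a xor b ≡ a
xor-false a refl = xor-identityʳ a

xor-true : ∀ a {b} → b ≡ true → a xor b ≡ not a
xor-true a refl = trans (xor-comm a true) (true-xor a)

double-suc : ∀ t → suc t + suc t ≡ suc (suc (t + t))
double-suc t = cong suc (ℕ.+-suc t t)

even-or-odd : ∀ n → Σ ℕ λ k → n ≡ k + k ⊎ n ≡ suc (k + k)
even-or-odd zero = 0 , inj₁ refl
even-or-odd (suc n) with even-or-odd n
... | k , inj₁ n≡ = k , inj₂ (cong suc n≡)
... | k , inj₂ n≡ = suc k , inj₁ (trans (cong suc n≡) (cong suc (sym (ℕ.+-suc k k))))

sum-map-allFin : ∀ {m} (f : Fin m → ℕ) → sum (map f (allFin m)) ≡ sum (tabulate f)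
sum-map-allFin f = cong sum (map-tabulate (λ i → i) f)

sum-tabulate-suc : ∀ {m} (f g : Fin m → ℕ) p → f p ≡ suc (g p) → (∀ q → q ≢ p → f q ≡ g q) →
                   sum (tabulate f) ≡ suc (sum (tabulate g))
sum-tabulate-suc f g fzero fp≡ rest =
  cong₂ _+_ fp≡ (cong sum (tabulate-cong (λ q → rest (fsuc q) (λ ()))))
sum-tabulate-suc f g (fsuc p) fp≡ rest = begin
  f fzero + sum (tabulate (λ q → f (fsuc q)))
    ≡⟨ cong₂ _+_ (rest fzero (λ ())) (sum-tabulate-suc _ _ p fp≡ rest′) ⟩
  g fzero + suc (sum (tabulate (λ q → g (fsuc q))))
    ≡⟨ ℕ.+-suc (g fzero) _ ⟩
  suc (g fzero + sum (tabulate (λ q → g (fsuc q))))  ∎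
  where
  rest′ : ∀ q → q ≢ p → f (fsuc q) ≡ g (fsuc q)
  rest′ q q≢p = rest (fsuc q) (λ eq → q≢p (suc-injective eq))

module AddMod (k : ℕ) where
  private
    K : ℕ
    K = suc k

  toℕ-addMod : ∀ (j : Fin K) a → toℕ (addMod j a) ≡ (toℕ j + a) % K
  toℕ-addMod j a = toℕ-fromℕ< _

  addMod-+ : ∀ (j : Fin K) a b → addMod (addMod j a) b ≡ addMod j (a + b)
  addMod-+ j a b = toℕ-injective (begin
    toℕ (addMod (addMod j a) b)  ≡⟨ toℕ-addMod (addMod j a) b ⟩
    (toℕ (addMod j a) + b) % K   ≡⟨ cong (λ t → (t + b) % K) (toℕ-addMod j a) ⟩
    ((toℕ j + a) % K + b) % K    ≡⟨ [m%n+o]%n≡[m+o]%n (toℕ j + a) b K ⟩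
    (toℕ j + a + b) % K          ≡⟨ cong (_% K) (ℕ.+-assoc (toℕ j) a b) ⟩
    (toℕ j + (a + b)) % K        ≡⟨ toℕ-addMod j (a + b) ⟨
    toℕ (addMod j (a + b))       ∎)

  addMod-K : ∀ (j : Fin K) → addMod j K ≡ j
  addMod-K j = toℕ-injective (begin
    toℕ (addMod j K)  ≡⟨ toℕ-addMod j K ⟩
    (toℕ j + K) % K   ≡⟨ [m+n]%n≡m%n (toℕ j) K ⟩
    toℕ j % K         ≡⟨ m<n⇒m%n≡m (toℕ<n j) ⟩
    toℕ j             ∎)

  addMod-comm : ∀ (j : Fin K) a b → addMod (addMod j a) b ≡ addMod (addMod j b) a
  addMod-comm j a b = begin
    addMod (addMod j a) b  ≡⟨ addMod-+ j a b ⟩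
    addMod j (a + b)       ≡⟨ cong (addMod j) (ℕ.+-comm a b) ⟩
    addMod j (b + a)       ≡⟨ addMod-+ j b a ⟨
    addMod (addMod j b) a  ∎

  addMod-inverse : ∀ (j : Fin K) a → a ≤ K → addMod (addMod j a) (K ∸ a) ≡ j
  addMod-inverse j a a≤K = begin
    addMod (addMod j a) (K ∸ a)  ≡⟨ addMod-+ j a (K ∸ a) ⟩
    addMod j (a + (K ∸ a))       ≡⟨ cong (addMod j) (ℕ.m+[n∸m]≡n a≤K) ⟩
    addMod j K                   ≡⟨ addMod-K j ⟩
    j                            ∎

  addMod-injective : ∀ (j j′ : Fin K) a → a ≤ K → addMod j a ≡ addMod j′ a → j ≡ j′
  addMod-injective j j′ a a≤K eq = begin
    j                             ≡⟨ addMod-inverse j a a≤K ⟨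
    addMod (addMod j a) (K ∸ a)   ≡⟨ cong (λ t → addMod t (K ∸ a)) eq ⟩
    addMod (addMod j′ a) (K ∸ a)  ≡⟨ addMod-inverse j′ a a≤K ⟩
    j′                            ∎

  addMod-1≢ : 1 ≤ k → ∀ (j : Fin K) → addMod j 1 ≢ j
  addMod-1≢ 1≤k j eq with ℕ.m≤n⇒m<n∨m≡n (toℕ<n j)
  ... | inj₁ 1+j<K = ℕ.1+n≢n (begin
    suc (toℕ j)        ≡⟨ m<n⇒m%n≡m 1+j<K ⟨
    suc (toℕ j) % K    ≡⟨ cong (_% K) (ℕ.+-comm 1 (toℕ j)) ⟩
    (toℕ j + 1) % K    ≡⟨ toℕ-addMod j 1 ⟨
    toℕ (addMod j 1)   ≡⟨ cong toℕ eq ⟩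
    toℕ j              ∎)
  ... | inj₂ 1+j≡K = ℕ.<⇒≢ (s≤s 1≤k) (begin
    1                   ≡⟨ cong suc (n%n≡0 K) ⟨
    suc (K % K)         ≡⟨ cong (λ t → suc (t % K)) (trans (ℕ.+-comm (toℕ j) 1) 1+j≡K) ⟨
    suc ((toℕ j + 1) % K) ≡⟨ cong suc (toℕ-addMod j 1) ⟨
    suc (toℕ (addMod j 1)) ≡⟨ cong (λ t → suc (toℕ t)) eq ⟩
    suc (toℕ j)         ≡⟨ 1+j≡K ⟩
    K                   ∎)

  addMod-parity : 2 ∣ K → ∀ (j : Fin K) a → toℕ (addMod j a) % 2 ≡ (toℕ j + a) % 2
  addMod-parity 2∣K j a = trans (cong (_% 2) (toℕ-addMod j a)) (m∣n⇒o%n%m≡o%m 2 K (toℕ j + a) 2∣K)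

module Torus (n k R : ℕ) (1≤n : 1 ≤ n) (1≤k : 1 ≤ k) (R≤K : R ≤ suc k)
             (2∣K : 2 ∣ suc k) (2∣R : 2 ∣ R) where
  open T (suc n) (suc k) R public
  private
    module Rows = AddMod n
    module Cols = AddMod k

  right left up : Vertex → Vertex
  right (i , j) = i , addMod j 1
  left (i , j) = i , addMod j k
  up (i , j) = addMod i 1 , (if lastRow i then addMod j R else j)

  left-right : ∀ v → left (right v) ≡ v
  left-right (i , j) = cong (i ,_) (trans (Cols.addMod-+ j 1 k) (Cols.addMod-K j))

  right-left : ∀ v → right (left v) ≡ v
  right-left (i , j) =
    cong (i ,_) (trans (Cols.addMod-comm j k 1) (trans (Cols.addMod-+ j 1 k) (Cols.addMod-K j)))

  right-injective : ∀ {v w} → right v ≡ right w → v ≡ w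
  right-injective {v} {w} eq = trans (sym (left-right v)) (trans (cong left eq) (left-right w))

  left-injective : ∀ {v w} → left v ≡ left w → v ≡ w
  left-injective {v} {w} eq = trans (sym (right-left v)) (trans (cong right eq) (right-left w))

  up-right : ∀ v → up (right v) ≡ right (up v)
  up-right (i , j) with lastRow i
  ... | true = cong (addMod i 1 ,_) (Cols.addMod-comm j 1 R)
  ... | false = refl

  up-left : ∀ v → up (left v) ≡ left (up v)
  up-left (i , j) with lastRow i
  ... | true = cong (addMod i 1 ,_) (Cols.addMod-comm j k R)
  ... | false = refl

  up-injective : ∀ {v w} → up v ≡ up w → v ≡ w
  up-injective {i , j} {i′ , j′} eq with Rows.addMod-injective i i′ 1 (s≤s z≤n) (cong proj₁ eq)
  ... | refl with lastRow i | cong proj₂ eq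
  ... | true | eq₂ = cong (i ,_) (Cols.addMod-injective j j′ R R≤K eq₂)
  ... | false | eq₂ = cong (i ,_) eq₂

  up-row≢ : ∀ v → proj₁ (up v) ≢ proj₁ v
  up-row≢ (i , j) = Rows.addMod-1≢ 1≤n i

  up≢ : ∀ v → up v ≢ v
  up≢ v eq = up-row≢ v (cong proj₁ eq)

  right≢ : ∀ v → right v ≢ v
  right≢ (i , j) eq = Cols.addMod-1≢ 1≤k j (cong proj₂ eq)

  parity : Vertex → ℕ
  parity v = toℕ (proj₂ v) % 2

  parity-up : ∀ v → parity (up v) ≡ parity v
  parity-up (i , j) with lastRow i
  ... | true = trans (Cols.addMod-parity 2∣K j R) (%-remove-+ʳ (toℕ j) 2∣R)
  ... | false = refl

  parity-right : ∀ v → parity (right v) ≢ parity v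
  parity-right (i , j) eq = [m+1]%2≢m%2 (toℕ j) (trans (sym (Cols.addMod-parity 2∣K j 1)) eq)

  parity-left : ∀ v → parity (left v) ≢ parity v
  parity-left v eq = parity-right (left v) (trans (cong parity (right-left v)) (sym eq))

  up^ : ℕ → Vertex → Vertex
  up^ zero v = v
  up^ (suc t) v = up (up^ t v)

  up^-up : ∀ t v → up^ t (up v) ≡ up (up^ t v)
  up^-up zero v = refl
  up^-up (suc t) v = cong up (up^-up t v)

  up^-+ : ∀ a b v → up^ (a + b) v ≡ up^ a (up^ b v)
  up^-+ zero b v = refl
  up^-+ (suc a) b v = cong up (up^-+ a b v)

  up^-injective : ∀ t {v w} → up^ t v ≡ up^ t w → v ≡ w
  up^-injective zero eq = eq
  up^-injective (suc t) eq = up^-injective t (up-injective eq)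

  parity-up^ : ∀ t v → parity (up^ t v) ≡ parity v
  parity-up^ zero v = refl
  parity-up^ (suc t) v = trans (parity-up (up^ t v)) (parity-up^ t v)

  up^-right : ∀ t v → up^ t (right v) ≡ right (up^ t v)
  up^-right zero v = refl
  up^-right (suc t) v = trans (cong up (up^-right t v)) (up-right (up^ t v))

  up^-left : ∀ t v → up^ t (left v) ≡ left (up^ t v)
  up^-left zero v = refl
  up^-left (suc t) v = trans (cong up (up^-left t v)) (up-left (up^ t v))

  hEdge vEdge : Vertex → Edge
  hEdge v = hor , v
  vEdge v = ver , v

  edgeEq-refl : ∀ e → edgeEq e e ≡ true
  edgeEq-refl (κ , i , j) rewrite dec-true (i ≟ᶠ i) refl | dec-true (j ≟ᶠ j) refl = kind≟-refl κ
    where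
    kind≟-refl : ∀ κ → kind≟ κ κ ∧ true ∧ true ≡ true
    kind≟-refl hor = refl
    kind≟-refl ver = refl

  edgeEq-sound : ∀ e e′ → edgeEq e e′ ≡ true → e ≡ e′
  edgeEq-sound (κ , i , j) (κ′ , i′ , j′) eq with kind≟ κ κ′ in κ≟κ′ | i ≟ᶠ i′ | j ≟ᶠ j′
  ... | true | yes refl | yes refl = cong (_, i , j) (kind≟-sound κ κ′ κ≟κ′)
    where
    kind≟-sound : ∀ κ κ′ → kind≟ κ κ′ ≡ true → κ ≡ κ′
    kind≟-sound hor hor _ = refl
    kind≟-sound ver ver _ = refl
  edgeEq-sound _ _ () | true | yes _ | no _
  edgeEq-sound _ _ () | true | no _ | _
  edgeEq-sound _ _ () | false | _ | _

  edgeEq-complete : ∀ e e′ → e ≢ e′ → edgeEq e e′ ≡ false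
  edgeEq-complete e e′ e≢e′ with edgeEq e e′ in eq
  ... | true = ⊥-elim (e≢e′ (edgeEq-sound e e′ eq))
  ... | false = refl

  OneOf : Edge → Edge → Edge → Edge → Edge → Set
  OneOf e e₁ e₂ e₃ e₄ = e ≡ e₁ ⊎ e ≡ e₂ ⊎ e ≡ e₃ ⊎ e ≡ e₄

  inFace-sound : ∀ f e → inFace f e ≡ true → OneOf e (fEdge₁ f) (fEdge₂ f) (fEdge₃ f) (fEdge₄ f)
  inFace-sound f e eq
    with edgeEq e (fEdge₁ f) in eq₁ | edgeEq e (fEdge₂ f) in eq₂
       | edgeEq e (fEdge₃ f) in eq₃ | edgeEq e (fEdge₄ f) in eq₄
  ... | true | _ | _ | _ = inj₁ (edgeEq-sound _ _ eq₁)
  ... | false | true | _ | _ = inj₂ (inj₁ (edgeEq-sound _ _ eq₂))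
  ... | false | false | true | _ = inj₂ (inj₂ (inj₁ (edgeEq-sound _ _ eq₃)))
  ... | false | false | false | true = inj₂ (inj₂ (inj₂ (edgeEq-sound _ _ eq₄)))
  inFace-sound f e () | false | false | false | false

  inFace-complete : ∀ f e → OneOf e (fEdge₁ f) (fEdge₂ f) (fEdge₃ f) (fEdge₄ f) → inFace f e ≡ true
  inFace-complete f e (inj₁ refl) rewrite edgeEq-refl e = refl
  inFace-complete f e (inj₂ (inj₁ refl)) rewrite edgeEq-refl e = ∨-zeroʳ (edgeEq e (fEdge₁ f))
  inFace-complete f e (inj₂ (inj₂ (inj₁ refl))) rewrite edgeEq-refl e =
    ∨-true (edgeEq e (fEdge₁ f)) (∨-zeroʳ (edgeEq e (fEdge₂ f)))
  inFace-complete f e (inj₂ (inj₂ (inj₂ refl))) rewrite edgeEq-refl e =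
    ∨-true (edgeEq e (fEdge₁ f)) (∨-true (edgeEq e (fEdge₂ f)) (∨-zeroʳ (edgeEq e (fEdge₃ f))))

  inFace-false : ∀ f e → e ≢ fEdge₁ f → e ≢ fEdge₂ f → e ≢ fEdge₃ f → e ≢ fEdge₄ f → inFace f e ≡ false
  inFace-false f e ≢₁ ≢₂ ≢₃ ≢₄
    rewrite edgeEq-complete _ _ ≢₁ | edgeEq-complete _ _ ≢₂
          | edgeEq-complete _ _ ≢₃ | edgeEq-complete _ _ ≢₄ = refl

  -- Flipping an alternating square

  matching-unique : ∀ {M} → IsPerfectMatching M → ∀ {x e e′} →
                    M e ≡ true → Incident x e → M e′ ≡ true → Incident x e′ → e ≡ e′
  matching-unique pm {x} Me x∈e Me′ x∈e′ with pm x
  ... | _ , _ , _ , unique = trans (unique _ Me x∈e) (sym (unique _ Me′ x∈e′))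

  record Square : Set where
    field
      a b c d : Vertex
      e₁ e₂ e₃ e₄ : Edge
      a∈e₁ : Incident a e₁
      b∈e₁ : Incident b e₁
      b∈e₂ : Incident b e₂
      c∈e₂ : Incident c e₂
      c∈e₃ : Incident c e₃
      d∈e₃ : Incident d e₃
      d∈e₄ : Incident d e₄
      a∈e₄ : Incident a e₄
      ends₁ : ∀ {x} → Incident x e₁ → x ≡ a ⊎ x ≡ b
      ends₂ : ∀ {x} → Incident x e₂ → x ≡ b ⊎ x ≡ c
      ends₃ : ∀ {x} → Incident x e₃ → x ≡ c ⊎ x ≡ d
      ends₄ : ∀ {x} → Incident x e₄ → x ≡ d ⊎ x ≡ a
      a≢b : a ≢ b
      a≢c : a ≢ c
      a≢d : a ≢ d
      b≢c : b ≢ c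
      b≢d : b ≢ d
      c≢d : c ≢ d

  module SquareFlip (S : Square) (M F : EdgeSet) (pm : IsPerfectMatching M)
     (F-sound : ∀ e → F e ≡ true → OneOf e (Square.e₁ S) (Square.e₂ S) (Square.e₃ S) (Square.e₄ S))
     (F₁ : F (Square.e₁ S) ≡ true) (F₂ : F (Square.e₂ S) ≡ true)
     (F₃ : F (Square.e₃ S) ≡ true) (F₄ : F (Square.e₄ S) ≡ true)
     (M₁ : M (Square.e₁ S) ≡ true) (M₃ : M (Square.e₃ S) ≡ true) where
    open Square S

    M′ : EdgeSet
    M′ e = M e xor F e

    M₂-false : M e₂ ≡ false
    M₂-false with M e₂ in M₂
    ... | false = refl
    ... | true = ⊥-elim ([ ≢-sym a≢c , ≢-sym b≢c ]
                   (ends₁ (subst (Incident c) (matching-unique pm M₂ b∈e₂ M₁ b∈e₁) c∈e₂)))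

    M₄-false : M e₄ ≡ false
    M₄-false with M e₄ in M₄
    ... | false = refl
    ... | true = ⊥-elim ([ a≢c , a≢d ]
                   (ends₃ (subst (Incident a) (matching-unique pm M₄ d∈e₄ M₃ d∈e₃) a∈e₄)))

    OnlyMatchedBy : EdgeSet → Vertex → Edge → Set
    OnlyMatchedBy X w e₀ = ∀ e → X e ≡ true → Incident w e → e ≡ e₀

    no-flipped-edge-at : ∀ {w e₀} → OnlyMatchedBy M w e₀ → F e₀ ≡ false →
                         ∀ {e} → M e ≡ true → Incident w e → F e ≡ true → ⊥
    no-flipped-edge-at unique F₀ Me w∈e Fe = not-¬ (subst (λ e → F e ≡ true) (unique _ Me w∈e) Fe) F₀

    unflipped-partner : ∀ {w e₀} → OnlyMatchedBy M w e₀ → F e₀ ≡ false → OnlyMatchedBy M′ w e₀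
    unflipped-partner unique F₀ e M′e w∈e with xor≡true (M e) (F e) M′e
    ... | inj₁ (Me , _) = unique e Me w∈e
    ... | inj₂ (¬Me , Fe) with F-sound e Fe
    ... | inj₁ refl = ⊥-elim (not-¬ M₁ ¬Me)
    ... | inj₂ (inj₂ (inj₁ refl)) = ⊥-elim (not-¬ M₃ ¬Me)
    ... | inj₂ (inj₁ refl) = ⊥-elim ([ (λ { refl → no-flipped-edge-at unique F₀ M₁ b∈e₁ F₁ })
                                     , (λ { refl → no-flipped-edge-at unique F₀ M₃ c∈e₃ F₃ })
                                     ] (ends₂ w∈e))
    ... | inj₂ (inj₂ (inj₂ refl)) = ⊥-elim ([ (λ { refl → no-flipped-edge-at unique F₀ M₃ d∈e₃ F₃ })
                                           , (λ { refl → no-flipped-edge-at unique F₀ M₁ a∈e₁ F₁ })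
                                           ] (ends₄ w∈e))

    flipped-partner : ∀ {w e₀ e′} → OnlyMatchedBy M w e₀ → F e₀ ≡ true →
                      (Incident w e₂ → e₂ ≡ e′) → (Incident w e₄ → e₄ ≡ e′) → OnlyMatchedBy M′ w e′
    flipped-partner unique F₀ w∈e₂ w∈e₄ e M′e w∈e with xor≡true (M e) (F e) M′e
    ... | inj₁ (Me , ¬Fe) = ⊥-elim (not-¬ (subst (λ e → F e ≡ true) (sym (unique e Me w∈e)) F₀) ¬Fe)
    ... | inj₂ (¬Me , Fe) with F-sound e Fe
    ... | inj₁ refl = ⊥-elim (not-¬ M₁ ¬Me)
    ... | inj₂ (inj₁ refl) = w∈e₂ w∈e
    ... | inj₂ (inj₂ (inj₁ refl)) = ⊥-elim (not-¬ M₃ ¬Me)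
    ... | inj₂ (inj₂ (inj₂ refl)) = w∈e₄ w∈e

    M′₂ : M′ e₂ ≡ true
    M′₂ = cong₂ _xor_ M₂-false F₂

    M′₄ : M′ e₄ ≡ true
    M′₄ = cong₂ _xor_ M₄-false F₄

    a-partner : OnlyMatchedBy M a e₁ → OnlyMatchedBy M′ a e₄
    a-partner unique =
      flipped-partner unique F₁ (λ a∈e₂ → ⊥-elim ([ a≢b , a≢c ] (ends₂ a∈e₂))) (λ _ → refl)

    b-partner : OnlyMatchedBy M b e₁ → OnlyMatchedBy M′ b e₂
    b-partner unique =
      flipped-partner unique F₁ (λ _ → refl) (λ b∈e₄ → ⊥-elim ([ b≢d , ≢-sym a≢b ] (ends₄ b∈e₄)))

    c-partner : OnlyMatchedBy M c e₃ → OnlyMatchedBy M′ c e₂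
    c-partner unique =
      flipped-partner unique F₃ (λ _ → refl) (λ c∈e₄ → ⊥-elim ([ c≢d , ≢-sym a≢c ] (ends₄ c∈e₄)))

    d-partner : OnlyMatchedBy M d e₃ → OnlyMatchedBy M′ d e₄
    d-partner unique =
      flipped-partner unique F₃ (λ d∈e₂ → ⊥-elim ([ ≢-sym b≢d , ≢-sym c≢d ] (ends₂ d∈e₂))) (λ _ → refl)

    flip-perfect : IsPerfectMatching M′
    flip-perfect w with pm w
    ... | e₀ , M₀ , w∈e₀ , unique with F e₀ in F₀
    ... | false = e₀ , cong₂ _xor_ M₀ F₀ , w∈e₀ , unflipped-partner unique F₀
    ... | true with F-sound e₀ F₀
    ... | inj₂ (inj₁ refl) = ⊥-elim (not-¬ M₀ M₂-false)
    ... | inj₂ (inj₂ (inj₂ refl)) = ⊥-elim (not-¬ M₀ M₄-false)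
    ... | inj₁ refl = [ (λ { refl → e₄ , M′₄ , a∈e₄ , a-partner unique })
                      , (λ { refl → e₂ , M′₂ , b∈e₂ , b-partner unique })
                      ] (ends₁ w∈e₀)
    ... | inj₂ (inj₂ (inj₁ refl)) = [ (λ { refl → e₂ , M′₂ , c∈e₂ , c-partner unique })
                                    , (λ { refl → e₄ , M′₄ , d∈e₄ , d-partner unique })
                                    ] (ends₃ w∈e₀)

  -- Counting horizontal edges

  private
    indicator : Bool → ℕ
    indicator b = if b then 1 else 0

  rowCount : EdgeSet → Fin (suc n) → ℕ
  rowCount X i = sum (tabulate (λ j → indicator (X (hor , i , j))))

  hcount-tabulate : ∀ X → hcount X ≡ sum (tabulate (rowCount X))
  hcount-tabulate X = trans (sum-map-allFin row) (cong sum (tabulate-cong (λ i → sum-map-allFin (entry i))))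
    where
    entry : Fin (suc n) → Fin (suc k) → ℕ
    entry i j = indicator (X (hor , i , j))
    row : Fin (suc n) → ℕ
    row i = sum (map (entry i) (allFin (suc k)))

  hcount-suc : ∀ X Y p → X (hEdge p) ≡ true → Y (hEdge p) ≡ false →
               (∀ v → v ≢ p → X (hEdge v) ≡ Y (hEdge v)) → hcount X ≡ suc (hcount Y)
  hcount-suc X Y (pᵢ , pⱼ) Xp Yp agree = begin
    hcount X                           ≡⟨ hcount-tabulate X ⟩
    sum (tabulate (rowCount X))        ≡⟨ sum-tabulate-suc _ _ pᵢ row-pᵢ other-rows ⟩
    suc (sum (tabulate (rowCount Y)))  ≡⟨ cong suc (hcount-tabulate Y) ⟨
    suc (hcount Y)                     ∎
    where
    row-pᵢ : rowCount X pᵢ ≡ suc (rowCount Y pᵢ)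
    row-pᵢ = sum-tabulate-suc (λ j → indicator (X (hor , pᵢ , j))) (λ j → indicator (Y (hor , pᵢ , j)))
               pⱼ
               (trans (cong indicator Xp) (cong (λ b → suc (indicator b)) (sym Yp)))
               (λ j j≢pⱼ → cong indicator (agree (pᵢ , j) (λ eq → j≢pⱼ (cong proj₂ eq))))
    other-rows : ∀ i → i ≢ pᵢ → rowCount X i ≡ rowCount Y i
    other-rows i i≢pᵢ =
      cong sum (tabulate-cong (λ j → cong indicator (agree (i , j) (λ eq → i≢pᵢ (cong proj₁ eq)))))

  hcount-suc-suc : ∀ X Y p q → p ≢ q → X (hEdge p) ≡ true → X (hEdge q) ≡ true →
                   Y (hEdge p) ≡ false → Y (hEdge q) ≡ false →
                   (∀ v → v ≢ p → v ≢ q → X (hEdge v) ≡ Y (hEdge v)) → hcount X ≡ suc (suc (hcount Y))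
  hcount-suc-suc X Y p q p≢q Xp Xq Yp Yq agree =
    trans (hcount-suc X Z p Xp Zp (λ v v≢p → sym (Z-agree v v≢p)))
          (cong suc (hcount-suc Z Y q Zq Yq Z-agree-Y))
    where
    Z : EdgeSet
    Z e = if edgeEq e (hEdge p) then false else X e
    Zp : Z (hEdge p) ≡ false
    Zp rewrite edgeEq-refl (hEdge p) = refl
    Z-agree : ∀ v → v ≢ p → Z (hEdge v) ≡ X (hEdge v)
    Z-agree v v≢p rewrite edgeEq-complete (hEdge v) (hEdge p) (λ eq → v≢p (cong proj₂ eq)) = refl
    Zq : Z (hEdge q) ≡ true
    Zq = trans (Z-agree q (≢-sym p≢q)) Xq
    Z-agree-Y : ∀ v → v ≢ q → Z (hEdge v) ≡ Y (hEdge v)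
    Z-agree-Y v v≢q with ≡-dec _≟ᶠ_ _≟ᶠ_ v p
    ... | yes refl = trans Zp (sym Yp)
    ... | no v≢p = trans (Z-agree v v≢p) (agree v v≢p v≢q)

  flipAt : EdgeSet → Face → EdgeSet
  flipAt M f e = M e xor inFace f e

  -- The face at u read with its horizontal edges, resp. its vertical edges, as e₁ and e₃.
  horizontalSquare verticalSquare : Vertex → Square
  horizontalSquare u = record
    { a = u ; b = right u ; c = up (right u) ; d = up u
    ; e₁ = hEdge u ; e₂ = vEdge (right u) ; e₃ = hEdge (up u) ; e₄ = vEdge u
    ; a∈e₁ = inj₁ refl ; b∈e₁ = inj₂ refl ; b∈e₂ = inj₁ refl ; c∈e₂ = inj₂ refl
    ; c∈e₃ = inj₂ (up-right u) ; d∈e₃ = inj₁ refl ; d∈e₄ = inj₂ refl ; a∈e₄ = inj₁ refl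
    ; ends₁ = λ x∈e → x∈e
    ; ends₂ = λ x∈e → x∈e
    ; ends₃ = λ { (inj₁ eq) → inj₂ eq ; (inj₂ eq) → inj₁ (trans eq (sym (up-right u))) }
    ; ends₄ = λ { (inj₁ eq) → inj₂ eq ; (inj₂ eq) → inj₁ eq }
    ; a≢b = ≢-sym (right≢ u)
    ; a≢c = λ eq → up-row≢ u (sym (cong proj₁ eq))
    ; a≢d = ≢-sym (up≢ u)
    ; b≢c = ≢-sym (up≢ (right u))
    ; b≢d = λ eq → up-row≢ u (sym (cong proj₁ eq))
    ; c≢d = λ eq → right≢ u (up-injective eq)
    }
  verticalSquare u = record
    { a = u ; b = up u ; c = up (right u) ; d = right u
    ; e₁ = vEdge u ; e₂ = hEdge (up u) ; e₃ = vEdge (right u) ; e₄ = hEdge u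
    ; a∈e₁ = inj₁ refl ; b∈e₁ = inj₂ refl ; b∈e₂ = inj₁ refl ; c∈e₂ = inj₂ (up-right u)
    ; c∈e₃ = inj₂ refl ; d∈e₃ = inj₁ refl ; d∈e₄ = inj₂ refl ; a∈e₄ = inj₁ refl
    ; ends₁ = λ x∈e → x∈e
    ; ends₂ = λ { (inj₁ eq) → inj₁ eq ; (inj₂ eq) → inj₂ (trans eq (sym (up-right u))) }
    ; ends₃ = λ { (inj₁ eq) → inj₂ eq ; (inj₂ eq) → inj₁ eq }
    ; ends₄ = λ { (inj₁ eq) → inj₂ eq ; (inj₂ eq) → inj₁ eq }
    ; a≢b = ≢-sym (up≢ u)
    ; a≢c = λ eq → up-row≢ u (sym (cong proj₁ eq))
    ; a≢d = ≢-sym (right≢ u)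
    ; b≢c = λ eq → right≢ u (sym (up-injective eq))
    ; b≢d = λ eq → up-row≢ u (cong proj₁ eq)
    ; c≢d = up≢ (right u)
    }

  flipAt-hEdge : ∀ M u v → v ≢ u → v ≢ up u → flipAt M u (hEdge v) ≡ M (hEdge v)
  flipAt-hEdge M u v v≢u v≢up = xor-false (M (hEdge v))
    (inFace-false u (hEdge v) (λ eq → v≢u (cong proj₂ eq)) (λ ())
                              (λ eq → v≢up (cong proj₂ eq)) (λ ()))

  flip-horizontal-face : ∀ M u → IsPerfectMatching M → M (hEdge u) ≡ true → M (hEdge (up u)) ≡ true →
    Flip M (flipAt M u) × IsPerfectMatching (flipAt M u) × hcount (flipAt M u) + 2 ≡ hcount M
  flip-horizontal-face M u pm M₁ M₃ =
    (u , inj₁ (M₁ , M₃ , M₂-false , M₄-false) , λ _ → refl) , flip-perfect , count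
    where
    open SquareFlip (horizontalSquare u) M (inFace u) pm (inFace-sound u)
      (inFace-complete u _ (inj₁ refl)) (inFace-complete u _ (inj₂ (inj₁ refl)))
      (inFace-complete u _ (inj₂ (inj₂ (inj₁ refl)))) (inFace-complete u _ (inj₂ (inj₂ (inj₂ refl))))
      M₁ M₃
    count : hcount (flipAt M u) + 2 ≡ hcount M
    count = trans (ℕ.+-comm _ 2) (sym (hcount-suc-suc M (flipAt M u) u (up u) (≢-sym (up≢ u)) M₁ M₃
              (cong₂ _xor_ M₁ (inFace-complete u _ (inj₁ refl)))
              (cong₂ _xor_ M₃ (inFace-complete u _ (inj₂ (inj₂ (inj₁ refl)))))
              (λ v v≢u v≢up → sym (flipAt-hEdge M u v v≢u v≢up))))

  flip-vertical-face : ∀ M u → IsPerfectMatching M → M (vEdge u) ≡ true → M (vEdge (right u)) ≡ true →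
    Flip M (flipAt M u) × IsPerfectMatching (flipAt M u) × hcount (flipAt M u) ≡ hcount M + 2
  flip-vertical-face M u pm M₁ M₃ =
    (u , inj₂ (M₃ , M₁ , M₄-false , M₂-false) , λ _ → refl) , flip-perfect , count
    where
    reversed : ∀ {e e₁ e₂ e₃ e₄} → OneOf e e₁ e₂ e₃ e₄ → OneOf e e₄ e₃ e₂ e₁
    reversed (inj₁ eq) = inj₂ (inj₂ (inj₂ eq))
    reversed (inj₂ (inj₁ eq)) = inj₂ (inj₂ (inj₁ eq))
    reversed (inj₂ (inj₂ (inj₁ eq))) = inj₂ (inj₁ eq)
    reversed (inj₂ (inj₂ (inj₂ eq))) = inj₁ eq
    open SquareFlip (verticalSquare u) M (inFace u) pm (λ e Fe → reversed (inFace-sound u e Fe))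
      (inFace-complete u _ (inj₂ (inj₂ (inj₂ refl)))) (inFace-complete u _ (inj₂ (inj₂ (inj₁ refl))))
      (inFace-complete u _ (inj₂ (inj₁ refl))) (inFace-complete u _ (inj₁ refl)) M₁ M₃
    count : hcount (flipAt M u) ≡ hcount M + 2
    count = trans (hcount-suc-suc (flipAt M u) M u (up u) (≢-sym (up≢ u)) M′₄ M′₂ M₄-false M₂-false
                     (λ v v≢u v≢up → flipAt-hEdge M u v v≢u v≢up))
                  (ℕ.+-comm 2 _)

  data Side : Set where
    toRight toLeft : Side

  across : Side → Vertex → Vertex
  across toRight = right
  across toLeft = left

  outEdge : Side → Vertex → Edge
  outEdge toRight v = hEdge v
  outEdge toLeft v = hEdge (left v)

  sideFace : Side → Vertex → Face
  sideFace toRight v = v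
  sideFace toLeft v = left v

  ∈outEdge : ∀ d v → Incident v (outEdge d v)
  ∈outEdge toRight v = inj₁ refl
  ∈outEdge toLeft v = inj₂ (sym (right-left v))

  across∈outEdge : ∀ d v → Incident (across d v) (outEdge d v)
  across∈outEdge toRight v = inj₂ refl
  across∈outEdge toLeft v = inj₁ refl

  up-across : ∀ d v → up (across d v) ≡ across d (up v)
  up-across toRight = up-right
  up-across toLeft = up-left

  up^-across : ∀ d t v → up^ t (across d v) ≡ across d (up^ t v)
  up^-across toRight = up^-right
  up^-across toLeft = up^-left

  across-injective : ∀ d {v w} → across d v ≡ across d w → v ≡ w
  across-injective toRight = right-injective
  across-injective toLeft = left-injective

  outEdge-injective : ∀ d {v w} → outEdge d v ≡ outEdge d w → v ≡ w
  outEdge-injective toRight eq = cong proj₂ eq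
  outEdge-injective toLeft eq = left-injective (cong proj₂ eq)

  vEdge-injective : ∀ {v w} → vEdge v ≡ vEdge w → v ≡ w
  vEdge-injective eq = cong proj₂ eq

  outEdge≢vEdge : ∀ {d v w} → outEdge d v ≢ vEdge w
  outEdge≢vEdge {toRight} ()
  outEdge≢vEdge {toLeft} ()

  parity-across : ∀ d v → parity (across d v) ≢ parity v
  parity-across toRight = parity-right
  parity-across toLeft = parity-left

  data IncidentEdge (d : Side) (v : Vertex) : Edge → Set where
    outward : IncidentEdge d v (outEdge d v)
    inward : ∀ w → across d w ≡ v → IncidentEdge d v (outEdge d w)
    upward : IncidentEdge d v (vEdge v)
    downward : ∀ w → up w ≡ v → IncidentEdge d v (vEdge w)

  incidentEdge : ∀ d v e → Incident v e → IncidentEdge d v e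
  incidentEdge toRight v (hor , w) (inj₁ refl) = outward
  incidentEdge toRight v (hor , w) (inj₂ refl) = inward w refl
  incidentEdge toLeft v (hor , w) (inj₁ refl) =
    subst (IncidentEdge toLeft v) (cong hEdge (left-right v)) (inward (right v) (left-right v))
  incidentEdge toLeft v (hor , w) (inj₂ refl) =
    subst (IncidentEdge toLeft (right w)) (cong hEdge (left-right w)) outward
  incidentEdge d v (ver , w) (inj₁ refl) = upward
  incidentEdge d v (ver , w) (inj₂ refl) = downward w refl

  flip-sideFace-horizontal : ∀ d M v → IsPerfectMatching M →
    M (outEdge d v) ≡ true → M (outEdge d (up v)) ≡ true →
    let M′ = flipAt M (sideFace d v) in Flip M M′ × IsPerfectMatching M′ × hcount M′ + 2 ≡ hcount M
  flip-sideFace-horizontal toRight M v pm M₁ M₃ = flip-horizontal-face M v pm M₁ M₃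
  flip-sideFace-horizontal toLeft M v pm M₁ M₃ =
    flip-horizontal-face M (left v) pm M₁ (subst (λ w → M (hEdge w) ≡ true) (sym (up-left v)) M₃)

  flip-sideFace-vertical : ∀ d M v → IsPerfectMatching M →
    M (vEdge v) ≡ true → M (vEdge (across d v)) ≡ true →
    let M′ = flipAt M (sideFace d v) in Flip M M′ × IsPerfectMatching M′ × hcount M′ ≡ hcount M + 2
  flip-sideFace-vertical toRight M v pm M₁ M₃ = flip-vertical-face M v pm M₁ M₃
  flip-sideFace-vertical toLeft M v pm M₁ M₃ =
    flip-vertical-face M (left v) pm M₃ (subst (λ w → M (vEdge w) ≡ true) (sym (right-left v)) M₁)

  inSideFace : ∀ d v e → OneOf e (outEdge d v) (outEdge d (up v)) (vEdge v) (vEdge (across d v)) →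
               inFace (sideFace d v) e ≡ true
  inSideFace toRight v e (inj₁ eq) = inFace-complete v e (inj₁ eq)
  inSideFace toRight v e (inj₂ (inj₁ eq)) = inFace-complete v e (inj₂ (inj₂ (inj₁ eq)))
  inSideFace toRight v e (inj₂ (inj₂ (inj₁ eq))) = inFace-complete v e (inj₂ (inj₂ (inj₂ eq)))
  inSideFace toRight v e (inj₂ (inj₂ (inj₂ eq))) = inFace-complete v e (inj₂ (inj₁ eq))
  inSideFace toLeft v e (inj₁ eq) = inFace-complete (left v) e (inj₁ eq)
  inSideFace toLeft v e (inj₂ (inj₁ eq)) =
    inFace-complete (left v) e (inj₂ (inj₂ (inj₁ (trans eq (cong hEdge (sym (up-left v)))))))
  inSideFace toLeft v e (inj₂ (inj₂ (inj₁ eq))) =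
    inFace-complete (left v) e (inj₂ (inj₁ (trans eq (cong vEdge (sym (right-left v))))))
  inSideFace toLeft v e (inj₂ (inj₂ (inj₂ eq))) = inFace-complete (left v) e (inj₂ (inj₂ (inj₂ eq)))

  notInSideFace : ∀ d v e →
    e ≢ outEdge d v → e ≢ outEdge d (up v) → e ≢ vEdge v → e ≢ vEdge (across d v) →
    inFace (sideFace d v) e ≡ false
  notInSideFace toRight v e ≢₁ ≢₂ ≢₃ ≢₄ = inFace-false v e ≢₁ ≢₄ ≢₂ ≢₃
  notInSideFace toLeft v e ≢₁ ≢₂ ≢₃ ≢₄ = inFace-false (left v) e ≢₁
    (λ eq → ≢₃ (trans eq (cong vEdge (right-left v))))
    (λ eq → ≢₂ (trans eq (cong hEdge (up-left v)))) ≢₄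

  flipAt-sideFace-toggles : ∀ d M v e →
    OneOf e (outEdge d v) (outEdge d (up v)) (vEdge v) (vEdge (across d v)) →
    flipAt M (sideFace d v) e ≡ not (M e)
  flipAt-sideFace-toggles d M v e e∈ = xor-true (M e) (inSideFace d v e e∈)

  flipAt-sideFace-keeps : ∀ d M v e →
    e ≢ outEdge d v → e ≢ outEdge d (up v) → e ≢ vEdge v → e ≢ vEdge (across d v) →
    flipAt M (sideFace d v) e ≡ M e
  flipAt-sideFace-keeps d M v e ≢₁ ≢₂ ≢₃ ≢₄ = xor-false (M e) (notInSideFace d v e ≢₁ ≢₂ ≢₃ ≢₄)

  -- Alternating segments

  ReducibleByFlips : EdgeSet → Set
  ReducibleByFlips M = Σ EdgeSet λ M′ → Flips M M′ × IsPerfectMatching M′ × hcount M′ + 2 ≡ hcount M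

  record AlternatingSegment (M : EdgeSet) (d : Side) (x : Vertex) (k : ℕ) : Set where
    field
      lowerEnd : M (outEdge d x) ≡ true
      upperEnd : M (outEdge d (up^ (suc (k + k)) x)) ≡ true
      interior : ∀ s → s < k → M (vEdge (up^ (suc (s + s)) x)) ≡ true
      noWrap : ∀ t → 0 < t → t ≤ suc (k + k) → up^ t x ≢ x

  up^-distinct : ∀ {x L} → (∀ t → 0 < t → t ≤ L → up^ t x ≢ x) →
                 ∀ a b → a < b → b ≤ L → up^ a x ≢ up^ b x
  up^-distinct {x} noWrap a b a<b b≤L eq =
    noWrap (b ∸ a) (ℕ.m<n⇒0<n∸m a<b) (ℕ.≤-trans (ℕ.m∸n≤m b a) b≤L) (sym (up^-injective a (begin
      up^ a x              ≡⟨ eq ⟩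
      up^ b x              ≡⟨ cong (λ t → up^ t x) (ℕ.m+[n∸m]≡n (ℕ.<⇒≤ a<b)) ⟨
      up^ (a + (b ∸ a)) x  ≡⟨ up^-+ a (b ∸ a) x ⟩
      up^ a (up^ (b ∸ a) x) ∎)))

  up^≢across : ∀ d x a b → up^ a x ≢ across d (up^ b x)
  up^≢across d x a b eq = parity-across d (up^ b x) (begin
    parity (across d (up^ b x))  ≡⟨ cong parity eq ⟨
    parity (up^ a x)             ≡⟨ parity-up^ a x ⟩
    parity x                     ≡⟨ parity-up^ b x ⟨
    parity (up^ b x)             ∎)

  noWrap-up : ∀ {x L} → (∀ t → 0 < t → t ≤ suc L → up^ t x ≢ x) →
              ∀ t → 0 < t → t ≤ L → up^ t (up x) ≢ up x
  noWrap-up {x} noWrap t 0<t t≤L eq =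
    noWrap t 0<t (ℕ.m≤n⇒m≤1+n t≤L) (up-injective (trans (sym (up^-up t x)) eq))

  module NeighbourColumn {M d x k} (pm : IsPerfectMatching M) (seg : AlternatingSegment M d x (suc k))
                         (y-out : M (outEdge d (across d (up x))) ≡ true) where
    open AlternatingSegment seg

    Z : ℕ → Vertex
    Z t = across d (up^ (suc (suc (t + t))) x)

    up-Z : ∀ t → up (Z t) ≡ across d (up^ (suc (suc (suc (t + t)))) x)
    up-Z t = up-across d _

    up-up-Z : ∀ t → up (up (Z t)) ≡ Z (suc t)
    up-up-Z t = begin
      up (up (Z t))                                     ≡⟨ cong up (up-Z t) ⟩
      up (across d (up^ (suc (suc (suc (t + t)))) x))   ≡⟨ up-across d _ ⟩
      across d (up^ (suc (suc (suc (suc (t + t))))) x)  ≡⟨ cong (λ i → across d (up^ (2 + i) x)) (double-suc t) ⟨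
      Z (suc t)                                         ∎

    -- Climb the neighbouring column from Z 0 = up (across d (up x)): each Z j is matched outward
    -- (and we stop) or upward. Inward is excluded by the interior of the segment, downward by the
    -- previous step, and climbing past Z k by the upper end of the segment.
    climb : ∀ f j → j + f ≡ k → (∀ t → t < j → M (vEdge (Z t)) ≡ true) →
            Σ ℕ λ s → s ≤ k × M (outEdge d (Z s)) ≡ true × (∀ t → t < s → M (vEdge (Z t)) ≡ true)
    climb f j j+f≡k below with pm (Z j)
    ... | e , Me , Zj∈e , _ with incidentEdge d (Z j) e Zj∈e
    ... | outward = j , j≤k , Me , below
      where
      j≤k : j ≤ k
      j≤k = subst (j ≤_) j+f≡k (ℕ.m≤m+n j f)
    ... | inward w across-w≡Zj =
      ⊥-elim (outEdge≢vEdge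
        (matching-unique pm Me′ (∈outEdge d _) (interior j (s≤s j≤k)) (inj₂ 2j+2≡)))
      where
      j≤k : j ≤ k
      j≤k = subst (j ≤_) j+f≡k (ℕ.m≤m+n j f)
      2j+2≡ : up^ (suc j + suc j) x ≡ up^ (suc (suc (j + j))) x
      2j+2≡ = cong (λ i → up^ i x) (double-suc j)
      Me′ : M (outEdge d (up^ (suc j + suc j) x)) ≡ true
      Me′ = subst (λ v → M (outEdge d v) ≡ true)
              (across-injective d (trans across-w≡Zj (cong (across d) (sym 2j+2≡)))) Me
    climb zero j j+0≡k below | e , Me , _ | upward =
      ⊥-elim (outEdge≢vEdge (matching-unique pm upperEnd (across∈outEdge d _) Me (inj₂ (sym up-Zk))))
      where
      j≡k : j ≡ k
      j≡k = trans (sym (ℕ.+-identityʳ j)) j+0≡k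
      up-Zk : up (Z j) ≡ across d (up^ (suc (suc k + suc k)) x)
      up-Zk = trans (up-Z j) (cong (λ i → across d (up^ (suc i) x))
                (trans (sym (double-suc j)) (cong (λ i → suc i + suc i) j≡k)))
    climb (suc f) j j+f+1≡k below | e , Me , _ | upward =
      climb f (suc j) (trans (sym (ℕ.+-suc j f)) j+f+1≡k) below′
      where
      below′ : ∀ t → t < suc j → M (vEdge (Z t)) ≡ true
      below′ t t<1+j with ℕ.m≤n⇒m<n∨m≡n (s≤s⁻¹ t<1+j)
      ... | inj₁ t<j = below t t<j
      ... | inj₂ refl = Me
    climb f zero _ _ | e , Me , _ | downward w up-w≡Z0 =
      ⊥-elim (outEdge≢vEdge (matching-unique pm y-out (∈outEdge d _) Me (inj₁ w≡y)))
      where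
      w≡y : across d (up x) ≡ w
      w≡y = up-injective (trans (up-across d (up x)) (sym up-w≡Z0))
    climb f (suc j) _ below | e , Me , _ | downward w up-w≡Z =
      ⊥-elim (up≢ (Z j) (sym (trans (vEdge-injective Zj-partner) (sym w≡upZ))))
      where
      w≡upZ : up (Z j) ≡ w
      w≡upZ = up-injective (trans (up-up-Z j) (sym up-w≡Z))
      Zj-partner : vEdge (Z j) ≡ vEdge w
      Zj-partner = matching-unique pm (below j (ℕ.n<1+n j)) (inj₂ refl) Me (inj₁ w≡upZ)

    neighbour-segment : Σ ℕ λ s → s ≤ k × AlternatingSegment M d (across d (up x)) s
    neighbour-segment with climb k 0 refl (λ _ ())
    ... | s , s≤k , top , below = s , s≤k , record
      { lowerEnd = y-out
      ; upperEnd = subst (λ v → M (outEdge d v) ≡ true) (sym (Z-from-y s)) top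
      ; interior = λ t t<s → subst (λ v → M (vEdge v) ≡ true) (sym (Z-from-y t)) (below t t<s)
      ; noWrap = λ t 0<t t≤ eq → noWrap-up noWrap t 0<t (ℕ.≤-trans t≤ (bound s≤k))
                   (across-injective d (trans (sym (up^-across d t (up x))) eq))
      }
      where
      Z-from-y : ∀ t → up^ (suc (t + t)) (across d (up x)) ≡ Z t
      Z-from-y t = trans (up^-across d (suc (t + t)) (up x)) (cong (across d) (up^-up (suc (t + t)) x))
      bound : ∀ {s} → s ≤ k → suc (s + s) ≤ suc k + suc k
      bound s≤k = s≤s (ℕ.+-mono-≤ s≤k (ℕ.m≤n⇒m≤1+n s≤k))

  module DoubleFlip {M d x k} (pm : IsPerfectMatching M) (seg : AlternatingSegment M d x (suc k))
                    (y-up : M (vEdge (across d (up x))) ≡ true) where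
    open AlternatingSegment seg

    L : ℕ
    L = suc (suc k + suc k)

    distinct : ∀ a b → a < b → b ≤ L → up^ a x ≢ up^ b x
    distinct = up^-distinct noWrap

    outEdge-distinct : ∀ a b → a < b → b ≤ L → outEdge d (up^ a x) ≢ outEdge d (up^ b x)
    outEdge-distinct a b a<b b≤L eq = distinct a b a<b b≤L (outEdge-injective d eq)

    up-x-vertical : M (vEdge (up x)) ≡ true
    up-x-vertical = interior 0 (s≤s z≤n)

    unmatched-beside : ∀ v → Incident v (vEdge (up x)) → M (outEdge d v) ≡ false
    unmatched-beside v v∈e with M (outEdge d v) in Mv
    ... | false = refl
    ... | true = ⊥-elim (outEdge≢vEdge (matching-unique pm Mv (∈outEdge d v) up-x-vertical v∈e))

    M₁ M₂ : EdgeSet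
    M₁ = flipAt M (sideFace d (up x))
    M₂ = flipAt M₁ (sideFace d x)

    first : Flip M M₁ × IsPerfectMatching M₁ × hcount M₁ ≡ hcount M + 2
    first = flip-sideFace-vertical d M (up x) pm up-x-vertical y-up

    M₁-x : M₁ (outEdge d x) ≡ true
    M₁-x = trans (flipAt-sideFace-keeps d M (up x) (outEdge d x)
                   (outEdge-distinct 0 1 (s≤s z≤n) (s≤s z≤n))
                   (outEdge-distinct 0 2 (s≤s z≤n) (s≤s (s≤s z≤n)))
                   outEdge≢vEdge outEdge≢vEdge)
                 lowerEnd

    M₁-up-x : M₁ (outEdge d (up x)) ≡ true
    M₁-up-x = trans (flipAt-sideFace-toggles d M (up x) _ (inj₁ refl))
                    (cong not (unmatched-beside (up x) (inj₁ refl)))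

    second : Flip M₁ M₂ × IsPerfectMatching M₂ × hcount M₂ + 2 ≡ hcount M₁
    second = flip-sideFace-horizontal d M₁ x (proj₁ (proj₂ first)) M₁-x M₁-up-x

    flips : Flips M M₂
    flips = proj₁ first ◅ proj₁ second ◅ ε

    M₂-perfect : IsPerfectMatching M₂
    M₂-perfect = proj₁ (proj₂ second)

    hcount-M₂ : hcount M₂ ≡ hcount M
    hcount-M₂ = ℕ.+-cancelʳ-≡ 2 _ _ (trans (proj₂ (proj₂ second)) (proj₂ (proj₂ first)))

    M₂-keeps : ∀ e → e ≢ outEdge d x → e ≢ outEdge d (up x) → e ≢ outEdge d (up (up x)) →
               e ≢ vEdge x → e ≢ vEdge (up x) → e ≢ vEdge (across d x) → e ≢ vEdge (across d (up x)) →
               M₂ e ≡ M e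
    M₂-keeps e ≢x ≢1 ≢2 ≢vx ≢v1 ≢ax ≢a1 =
      trans (flipAt-sideFace-keeps d M₁ x e ≢x ≢1 ≢vx ≢ax)
            (flipAt-sideFace-keeps d M (up x) e ≢1 ≢2 ≢v1 ≢a1)

    up²-up^ : ∀ t → up^ t (up (up x)) ≡ up^ (suc (suc t)) x
    up²-up^ t = trans (up^-up t (up x)) (cong up (up^-up t x))

    2<L : 2 < L
    2<L = s≤s (s≤s (ℕ.≤-trans (s≤s z≤n) (ℕ.m≤n+m (suc k) k)))

    shifted-lowerEnd : M₂ (outEdge d (up (up x))) ≡ true
    shifted-lowerEnd = begin
      M₂ (outEdge d (up (up x)))
        ≡⟨ flipAt-sideFace-keeps d M₁ x _
             (≢-sym (outEdge-distinct 0 2 (s≤s z≤n) (ℕ.<⇒≤ 2<L)))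
             (≢-sym (outEdge-distinct 1 2 ℕ.≤-refl (ℕ.<⇒≤ 2<L)))
             outEdge≢vEdge outEdge≢vEdge ⟩
      M₁ (outEdge d (up (up x)))
        ≡⟨ flipAt-sideFace-toggles d M (up x) _ (inj₂ (inj₁ refl)) ⟩
      not (M (outEdge d (up (up x))))
        ≡⟨ cong not (unmatched-beside (up (up x)) (inj₂ refl)) ⟩
      true ∎

    shifted-upperEnd : M₂ (outEdge d (up^ (suc (k + k)) (up (up x)))) ≡ true
    shifted-upperEnd = begin
      M₂ (outEdge d (up^ (suc (k + k)) (up (up x))))
        ≡⟨ cong (λ v → M₂ (outEdge d v)) (up²-up^ (suc (k + k))) ⟩
      M₂ (outEdge d (up^ (suc (suc (suc (k + k)))) x))
        ≡⟨ cong (λ i → M₂ (outEdge d (up^ (suc i) x))) (double-suc k) ⟨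
      M₂ (outEdge d (up^ L x))
        ≡⟨ M₂-keeps _ (≢-sym (outEdge-distinct 0 L (s≤s z≤n) ℕ.≤-refl))
             (≢-sym (outEdge-distinct 1 L (ℕ.<⇒≤ 2<L) ℕ.≤-refl))
             (≢-sym (outEdge-distinct 2 L 2<L ℕ.≤-refl))
             outEdge≢vEdge outEdge≢vEdge outEdge≢vEdge outEdge≢vEdge ⟩
      M (outEdge d (up^ L x))
        ≡⟨ upperEnd ⟩
      true ∎

    shifted-interior : ∀ s → s < k → M₂ (vEdge (up^ (suc (s + s)) (up (up x)))) ≡ true
    shifted-interior s s<k = begin
      M₂ (vEdge (up^ (suc (s + s)) (up (up x))))
        ≡⟨ cong (λ v → M₂ (vEdge v)) (up²-up^ (suc (s + s))) ⟩
      M₂ (vEdge (up^ j x))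
        ≡⟨ M₂-keeps _ (≢-sym outEdge≢vEdge) (≢-sym outEdge≢vEdge) (≢-sym outEdge≢vEdge)
             (λ eq → distinct 0 j (s≤s z≤n) j≤L (sym (vEdge-injective eq)))
             (λ eq → distinct 1 j (s≤s (s≤s z≤n)) j≤L (sym (vEdge-injective eq)))
             (λ eq → up^≢across d x j 0 (vEdge-injective eq))
             (λ eq → up^≢across d x j 1 (vEdge-injective eq)) ⟩
      M (vEdge (up^ j x))
        ≡⟨ cong (λ i → M (vEdge (up^ (suc i) x))) (double-suc s) ⟨
      M (vEdge (up^ (suc (suc s + suc s)) x))
        ≡⟨ interior (suc s) (s≤s s<k) ⟩
      true ∎
      where
      j : ℕ
      j = suc (suc (suc (s + s)))
      j≤L : j ≤ L
      j≤L = s≤s (subst (_≤ suc k + suc k) (double-suc s)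
                       (ℕ.+-mono-≤ (s≤s (ℕ.<⇒≤ s<k)) (s≤s (ℕ.<⇒≤ s<k))))

    shifted-segment : AlternatingSegment M₂ d (up (up x)) k
    shifted-segment = record
      { lowerEnd = shifted-lowerEnd
      ; upperEnd = shifted-upperEnd
      ; interior = shifted-interior
      ; noWrap = λ t 0<t t≤ →
          noWrap-up (noWrap-up noWrap) t 0<t (ℕ.≤-trans t≤ (ℕ.≤-reflexive (sym (ℕ.+-suc k k))))
      }

  segment-step : ∀ {M d x k} → IsPerfectMatching M → AlternatingSegment M d x (suc k) →
    (Σ ℕ λ s → s ≤ k × AlternatingSegment M d (across d (up x)) s) ⊎
    (Σ EdgeSet λ M′ → Flips M M′ × IsPerfectMatching M′ × hcount M′ ≡ hcount M ×
                      AlternatingSegment M′ d (up (up x)) k)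
  segment-step {M} {d} {x} pm seg with pm (across d (up x))
  ... | e , Me , y∈e , _ with incidentEdge d (across d (up x)) e y∈e
  ... | outward = inj₁ (NeighbourColumn.neighbour-segment pm seg Me)
  ... | upward = inj₂ (M₂ , flips , M₂-perfect , hcount-M₂ , shifted-segment)
    where open DoubleFlip pm seg Me
  ... | inward w across-w≡y =
    ⊥-elim (outEdge≢vEdge
      (matching-unique pm Me′ (∈outEdge d (up x)) (interior 0 (s≤s z≤n)) (inj₁ refl)))
    where
    open AlternatingSegment seg
    Me′ : M (outEdge d (up x)) ≡ true
    Me′ = subst (λ v → M (outEdge d v) ≡ true) (across-injective d across-w≡y) Me
  ... | downward w up-w≡y =
    ⊥-elim (outEdge≢vEdge (matching-unique pm lowerEnd (across∈outEdge d x) Me (inj₁ across-x≡w)))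
    where
    open AlternatingSegment seg
    across-x≡w : across d x ≡ w
    across-x≡w = up-injective (trans (up-across d x) (sym up-w≡y))

  segment-reducible : ∀ fuel k → k ≤ fuel → ∀ {M d x} →
                      IsPerfectMatching M → AlternatingSegment M d x k → ReducibleByFlips M
  segment-reducible _ zero _ {M} {d} {x} pm seg
    with flip-sideFace-horizontal d M x pm (AlternatingSegment.lowerEnd seg) (AlternatingSegment.upperEnd seg)
  ... | flip , pm′ , count = flipAt M (sideFace d x) , flip ◅ ε , pm′ , count
  segment-reducible (suc fuel) (suc k) (s≤s k≤fuel) pm seg with segment-step pm seg
  ... | inj₁ (s , s≤k , seg′) = segment-reducible fuel s (ℕ.≤-trans s≤k k≤fuel) pm seg′
  ... | inj₂ (M′ , flips , pm′ , same-count , seg′) with segment-reducible fuel k k≤fuel pm′ seg′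
  ... | M″ , flips′ , pm″ , count = M″ , flips ◅◅ flips′ , pm″ , trans count same-count

  -- Covered paths in a column

  data VerticalStep (e : Edge) (a b : Vertex) : Set where
    ascent : e ≡ vEdge a → b ≡ up a → VerticalStep e a b
    descent : e ≡ vEdge b → a ≡ up b → VerticalStep e a b

  vertical-ascent : ∀ e {a b} → kind e ≡ ver → ends e ≡ (a , b) → VerticalStep e a b
  vertical-ascent (ver , w) refl refl = ascent refl refl

  vertical-descent : ∀ e {a b} → kind e ≡ ver → ends e ≡ (b , a) → VerticalStep e a b
  vertical-descent (ver , w) refl refl = descent refl refl

  record ColumnPath (M : EdgeSet) (x₁ x₂ : Vertex) (len : ℕ) : Set where
    field
      P : ℕ → Vertex
      E : ℕ → Edge
      start : P 0 ≡ x₁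
      finish : P len ≡ x₂
      P-injective : ∀ {a b} → a ≤ len → b ≤ len → P a ≡ P b → a ≡ b
      step : ∀ j → j < len → VerticalStep (E j) (P j) (P (suc j))
      covered : ∀ j → 0 < j → j < len → Σ ℕ λ u → u < len × M (E u) ≡ true × Incident (P j) (E u)

  module _ {M x₁ x₂ len} (path : ColumnPath M x₁ x₂ len) where
    open ColumnPath path

    ends-E : ∀ {j v} → j < len → Incident v (E j) → v ≡ P j ⊎ v ≡ P (suc j)
    ends-E {j} {v} j<len v∈E with step j j<len
    ... | ascent E≡ up-Pj =
      [ inj₁ , (λ eq → inj₂ (trans eq (sym up-Pj))) ] (subst (Incident v) E≡ v∈E)
    ... | descent E≡ up-Pj+1 =
      [ inj₂ , (λ eq → inj₁ (trans eq (sym up-Pj+1))) ] (subst (Incident v) E≡ v∈E)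

    P∈E : ∀ j → j < len → Incident (P j) (E j)
    P∈E j j<len with step j j<len
    ... | ascent E≡ _ = subst (Incident (P j)) (sym E≡) (inj₁ refl)
    ... | descent E≡ up-Pj+1 = subst (Incident (P j)) (sym E≡) (inj₂ up-Pj+1)

    P-suc∈E : ∀ j → j < len → Incident (P (suc j)) (E j)
    P-suc∈E j j<len with step j j<len
    ... | ascent E≡ up-Pj = subst (Incident (P (suc j))) (sym E≡) (inj₂ up-Pj)
    ... | descent E≡ _ = subst (Incident (P (suc j))) (sym E≡) (inj₁ refl)

    E-vertical : ∀ j → j < len → Σ Vertex λ w → E j ≡ vEdge w
    E-vertical j j<len with step j j<len
    ... | ascent E≡ _ = _ , E≡
    ... | descent E≡ _ = _ , E≡

    P-suc≢ : ∀ j → suc j ≤ len → P j ≢ P (suc j)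
    P-suc≢ j j+1≤len eq = ℕ.1+n≢n (sym (P-injective (ℕ.≤-trans (ℕ.n≤1+n j) j+1≤len) j+1≤len eq))

    no-return : ∀ j → suc (suc j) ≤ len → P j ≢ P (suc (suc j))
    no-return j j+2≤len eq = ℕ.<⇒≢ (ℕ.<-trans (ℕ.n<1+n j) (ℕ.n<1+n (suc j)))
      (P-injective (ℕ.≤-trans (ℕ.n≤1+n j) (ℕ.≤-trans (ℕ.n≤1+n (suc j)) j+2≤len)) j+2≤len eq)

    covered-by-neighbour : ∀ i → suc i < len → M (E i) ≡ true ⊎ M (E (suc i)) ≡ true
    covered-by-neighbour i i+1<len with covered (suc i) (s≤s z≤n) i+1<len
    ... | u , u<len , MEu , P∈Eu with ends-E u<len P∈Eu
    ... | inj₁ eq = inj₂ (subst (λ j → M (E j) ≡ true) u≡i+1 MEu)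
      where
      u≡i+1 : u ≡ suc i
      u≡i+1 = sym (P-injective (ℕ.<⇒≤ i+1<len) (ℕ.<⇒≤ u<len) eq)
    ... | inj₂ eq = inj₁ (subst (λ j → M (E j) ≡ true) u≡i MEu)
      where
      u≡i : u ≡ i
      u≡i = sym (ℕ.suc-injective (P-injective (ℕ.<⇒≤ i+1<len) u<len eq))

    not-both-matched : ∀ {M′} → IsPerfectMatching M′ → ∀ i → suc i < len →
                       M′ (E i) ≡ true → M′ (E (suc i)) ≡ true → ⊥
    not-both-matched pm i i+1<len MEi MEi+1 =
      [ P-suc≢ i (ℕ.<⇒≤ i+1<len) , no-return i i+1<len ]
      (ends-E i+1<len (subst (Incident (P i)) same (P∈E i i<len)))
      where
      i<len : i < len
      i<len = ℕ.<-trans (ℕ.n<1+n i) i+1<len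
      same : E i ≡ E (suc i)
      same = matching-unique pm MEi (P-suc∈E i i<len) MEi+1 (P∈E (suc i) i+1<len)

    Ascent Descent : ℕ → Set
    Ascent j = E j ≡ vEdge (P j) × P (suc j) ≡ up (P j)
    Descent j = E j ≡ vEdge (P (suc j)) × P j ≡ up (P (suc j))

    ascent-continues : ∀ j → suc j < len → Ascent j → Ascent (suc j)
    ascent-continues j j+1<len (_ , up-Pj) with step (suc j) j+1<len
    ... | ascent E≡ up-P = E≡ , up-P
    ... | descent _ P≡up = ⊥-elim (no-return j j+1<len (up-injective (trans (sym up-Pj) P≡up)))

    descent-continues : ∀ j → suc j < len → Descent j → Descent (suc j)
    descent-continues j j+1<len (_ , Pj≡up) with step (suc j) j+1<len
    ... | descent E≡ P≡up = E≡ , P≡up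
    ... | ascent _ up-P = ⊥-elim (no-return j j+1<len (trans Pj≡up (sym up-P)))

    ascending : Ascent 0 → ∀ j → j < len → Ascent j
    ascending a₀ zero _ = a₀
    ascending a₀ (suc j) j+1<len =
      ascent-continues j j+1<len (ascending a₀ j (ℕ.<-trans (ℕ.n<1+n j) j+1<len))

    descending : Descent 0 → ∀ j → j < len → Descent j
    descending d₀ zero _ = d₀
    descending d₀ (suc j) j+1<len =
      descent-continues j j+1<len (descending d₀ j (ℕ.<-trans (ℕ.n<1+n j) j+1<len))

    ascending-positions : Ascent 0 → ∀ j → j ≤ len → P j ≡ up^ j x₁
    ascending-positions a₀ zero _ = start
    ascending-positions a₀ (suc j) j<len =
      trans (proj₂ (ascending a₀ j j<len)) (cong up (ascending-positions a₀ j (ℕ.<⇒≤ j<len)))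

    descending-positions : Descent 0 → ∀ t j → t + j ≡ len → up^ t x₂ ≡ P j
    descending-positions d₀ zero j j≡len = trans (sym finish) (cong P (sym j≡len))
    descending-positions d₀ (suc t) j t+1+j≡len = begin
      up (up^ t x₂)   ≡⟨ cong up (descending-positions d₀ t (suc j) (trans (ℕ.+-suc t j) t+1+j≡len)) ⟩
      up (P (suc j))  ≡⟨ proj₂ (descending d₀ j (subst (j <_) t+1+j≡len (s≤s (ℕ.m≤n+m j t)))) ⟨
      P j             ∎

  module _ {M x₁ x₂ len} (pm : IsPerfectMatching M) (d : Side)
           (x₁-out : M (outEdge d x₁) ≡ true) (x₂-out : M (outEdge d x₂) ≡ true)
           (path : ColumnPath M x₁ x₂ len) where
    open ColumnPath path

    blocked-by-outEdge : ∀ {v} → M (outEdge d v) ≡ true →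
                         ∀ j → j < len → M (E j) ≡ true → Incident v (E j) → ⊥
    blocked-by-outEdge Mv j j<len MEj v∈Ej with E-vertical path j j<len
    ... | w , Ej≡ = outEdge≢vEdge (trans (matching-unique pm Mv (∈outEdge d _) MEj v∈Ej) Ej≡)

    first-unmatched : 0 < len → M (E 0) ≡ true → ⊥
    first-unmatched 0<len ME0 =
      blocked-by-outEdge x₁-out 0 0<len ME0 (subst (λ v → Incident v (E 0)) start (P∈E path 0 0<len))

    odd-edges-matched : ∀ s → suc (s + s) < len → M (E (suc (s + s))) ≡ true
    odd-edges-matched zero 1<len =
      [ (λ ME0 → ⊥-elim (first-unmatched (ℕ.<-trans (s≤s z≤n) 1<len) ME0)) , (λ ME1 → ME1) ]
      (covered-by-neighbour path 0 1<len)
    odd-edges-matched (suc s) j<len =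
      [ (λ ME → ⊥-elim (not-both-matched path pm (suc (s + s)) i<len (odd-edges-matched s i-1<len) ME))
      , (λ ME → subst (λ j → M (E j) ≡ true) (sym j≡) ME)
      ] (covered-by-neighbour path (suc (suc (s + s))) (subst (_< len) j≡ j<len))
      where
      j≡ : suc (suc s + suc s) ≡ suc (suc (suc (s + s)))
      j≡ = cong suc (double-suc s)
      i<len : suc (suc (s + s)) < len
      i<len = ℕ.<-trans (ℕ.n<1+n _) (subst (_< len) j≡ j<len)
      i-1<len : suc (s + s) < len
      i-1<len = ℕ.<-trans (ℕ.n<1+n _) i<len

    odd-length : 0 < len → Σ ℕ λ k → len ≡ suc (k + k)
    odd-length 0<len with even-or-odd len
    ... | k , inj₂ len≡ = k , len≡
    ... | zero , inj₁ refl = ⊥-elim (ℕ.<-irrefl refl 0<len)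
    ... | suc k , inj₁ len≡ =
      ⊥-elim (blocked-by-outEdge x₂-out (suc (k + k)) last<len (odd-edges-matched k last<len) x₂∈E)
      where
      last<len : suc (k + k) < len
      last<len = subst (suc (k + k) <_) (sym (trans len≡ (double-suc k))) (ℕ.n<1+n _)
      x₂∈E : Incident x₂ (E (suc (k + k)))
      x₂∈E = subst (λ v → Incident v (E (suc (k + k))))
               (trans (cong P (sym (trans len≡ (double-suc k)))) finish) (P-suc∈E path _ last<len)

    odd<len : ∀ {k s} → len ≡ suc (k + k) → s < k → suc (s + s) < len
    odd<len len≡ s<k = subst (suc _ <_) (sym len≡) (s≤s (ℕ.+-mono-< s<k s<k))

    ascending-segment : Ascent path 0 → ∀ k → len ≡ suc (k + k) → AlternatingSegment M d x₁ k
    ascending-segment a₀ k len≡ = record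
      { lowerEnd = x₁-out
      ; upperEnd = subst (λ v → M (outEdge d v) ≡ true) (sym top) x₂-out
      ; interior = interior′
      ; noWrap = λ t 0<t t≤ eq → ℕ.<⇒≢ 0<t (sym (P-injective (t≤len t≤) z≤n
                   (trans (position t (t≤len t≤)) (trans eq (sym start)))))
      }
      where
      position : ∀ j → j ≤ len → P j ≡ up^ j x₁
      position = ascending-positions path a₀
      t≤len : ∀ {t} → t ≤ suc (k + k) → t ≤ len
      t≤len = subst (_ ≤_) (sym len≡)
      top : up^ (suc (k + k)) x₁ ≡ x₂
      top = trans (sym (position _ (t≤len ℕ.≤-refl))) (trans (cong P (sym len≡)) finish)
      interior′ : ∀ s → s < k → M (vEdge (up^ (suc (s + s)) x₁)) ≡ true
      interior′ s s<k = subst (λ e → M e ≡ true)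
        (trans (proj₁ (ascending path a₀ _ (odd<len len≡ s<k)))
               (cong vEdge (position _ (ℕ.<⇒≤ (odd<len len≡ s<k)))))
        (odd-edges-matched s (odd<len len≡ s<k))

    descending-segment : Descent path 0 → ∀ k → len ≡ suc (k + k) → AlternatingSegment M d x₂ k
    descending-segment d₀ k len≡ = record
      { lowerEnd = x₂-out
      ; upperEnd = subst (λ v → M (outEdge d v) ≡ true)
                     (sym (trans (position (suc (k + k)) 0 (trans (ℕ.+-identityʳ _) (sym len≡))) start)) x₁-out
      ; interior = interior′
      ; noWrap = noWrap′
      }
      where
      position : ∀ t j → t + j ≡ len → up^ t x₂ ≡ P j
      position = descending-positions path d₀
      interior′ : ∀ s → s < k → M (vEdge (up^ (suc (s + s)) x₂)) ≡ true
      interior′ s s<k with ℕ.m≤n⇒∃[o]m+o≡n s<k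
      ... | q , s+1+q≡k = subst (λ e → M e ≡ true)
              (trans (proj₁ (descending path d₀ _ q-odd<len)) (cong vEdge (sym (position _ _ indices))))
              (odd-edges-matched q q-odd<len)
        where
        q<k : q < k
        q<k = subst (q <_) s+1+q≡k (s≤s (ℕ.m≤n+m q s))
        q-odd<len : suc (q + q) < len
        q-odd<len = odd<len len≡ q<k
        indices : suc (s + s) + suc (suc (q + q)) ≡ len
        indices = trans (arith s q) (trans (cong (λ m → suc (m + m)) s+1+q≡k) (sym len≡))
          where
          arith : ∀ s q → suc (s + s) + suc (suc (q + q)) ≡ suc ((suc s + q) + (suc s + q))
          arith = solve-∀
      noWrap′ : ∀ t → 0 < t → t ≤ suc (k + k) → up^ t x₂ ≢ x₂
      noWrap′ t 0<t t≤ eq with ℕ.m≤n⇒∃[o]m+o≡n (subst (t ≤_) (sym len≡) t≤)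
      ... | j , t+j≡len =
        ℕ.<⇒≢ 0<t (sym (ℕ.+-cancelʳ-≡ len t 0 (trans (cong (t +_) (sym j≡len)) t+j≡len)))
        where
        j≡len : j ≡ len
        j≡len = P-injective (subst (j ≤_) t+j≡len (ℕ.m≤n+m j t)) ℕ.≤-refl
                  (trans (sym (position t j t+j≡len)) (trans eq (sym finish)))

    path-segment : 0 < len → Σ Vertex λ x → Σ ℕ λ k → AlternatingSegment M d x k
    path-segment 0<len with odd-length 0<len | step 0 0<len
    ... | k , len≡ | ascent E≡ up≡ = x₁ , k , ascending-segment (E≡ , up≡) k len≡
    ... | k , len≡ | descent E≡ P≡ = x₂ , k , descending-segment (E≡ , P≡) k len≡

  -- Index by ℕ, reducing modulo the length; only indices within the path are ever used.
  columnPath : ∀ {M C x₁ x₂} → x₁ ≢ x₂ → CoveredPath M C x₁ x₂ →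
               Σ ℕ λ len → 0 < len × ColumnPath M x₁ x₂ len
  columnPath x₁≢x₂ record { len = zero ; start = start ; finish = finish } =
    ⊥-elim (x₁≢x₂ (trans (sym start) finish))
  columnPath {M} {x₁ = x₁} {x₂} _ record { len = suc l ; p = p ; es = es ; start = start ; finish = finish
                                      ; distinct = distinct ; step = step ; covered = covered } =
    suc l , s≤s z≤n , record
      { P = P ; E = E ; start = start′ ; finish = finish′
      ; P-injective = P-injective ; step = step′ ; covered = covered′ }
    where
    len : ℕ
    len = suc l

    vertexIndex : ℕ → Fin (suc len)
    vertexIndex j = fromℕ< (m%n<n j (suc len))
    edgeIndex : ℕ → Fin len
    edgeIndex j = fromℕ< (m%n<n j len)

    toℕ-vertexIndex : ∀ {j} → j ≤ len → toℕ (vertexIndex j) ≡ j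
    toℕ-vertexIndex j≤len = trans (toℕ-fromℕ< _) (m<n⇒m%n≡m (s≤s j≤len))
    toℕ-edgeIndex : ∀ {j} → j < len → toℕ (edgeIndex j) ≡ j
    toℕ-edgeIndex j<len = trans (toℕ-fromℕ< _) (m<n⇒m%n≡m j<len)

    P : ℕ → Vertex
    P j = p (vertexIndex j)
    E : ℕ → Edge
    E j = es (edgeIndex j)

    P-injective : ∀ {a b} → a ≤ len → b ≤ len → P a ≡ P b → a ≡ b
    P-injective a≤ b≤ eq =
      trans (sym (toℕ-vertexIndex a≤)) (trans (cong toℕ (distinct eq)) (toℕ-vertexIndex b≤))

    start′ : P 0 ≡ x₁
    start′ = trans (cong p (toℕ-injective (toℕ-vertexIndex {0} z≤n))) start
    finish′ : P len ≡ x₂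
    finish′ =
      trans (cong p (toℕ-injective (trans (toℕ-vertexIndex {len} ℕ.≤-refl) (sym (toℕ-fromℕ len))))) finish

    inject₁-edgeIndex : ∀ {j} → j < len → inject₁ (edgeIndex j) ≡ vertexIndex j
    inject₁-edgeIndex {j} j<len = toℕ-injective
      (trans (toℕ-inject₁ (edgeIndex j)) (trans (toℕ-edgeIndex j<len) (sym (toℕ-vertexIndex (ℕ.<⇒≤ j<len)))))
    suc-edgeIndex : ∀ {j} → j < len → fsuc (edgeIndex j) ≡ vertexIndex (suc j)
    suc-edgeIndex {j} j<len =
      toℕ-injective (trans (cong suc (toℕ-edgeIndex j<len)) (sym (toℕ-vertexIndex j<len)))

    step′ : ∀ j → j < len → VerticalStep (E j) (P j) (P (suc j))
    step′ j j<len with step (edgeIndex j)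
    ... | E-vertical , inj₁ ends≡ = vertical-ascent (E j) E-vertical
      (trans ends≡ (cong₂ _,_ (cong p (inject₁-edgeIndex j<len)) (cong p (suc-edgeIndex j<len))))
    ... | E-vertical , inj₂ ends≡ = vertical-descent (E j) E-vertical
      (trans ends≡ (cong₂ _,_ (cong p (suc-edgeIndex j<len)) (cong p (inject₁-edgeIndex j<len))))

    covered′ : ∀ j → 0 < j → j < len → Σ ℕ λ u → u < len × M (E u) ≡ true × Incident (P j) (E u)
    covered′ j 0<j j<len with covered (edgeIndex j) (subst (0 <_) (sym (toℕ-edgeIndex j<len)) 0<j)
    ... | u , M-es-u , p∈es-u =
      toℕ u , toℕ<n u , subst (λ i → M (es i) ≡ true) (sym edgeIndex-u) M-es-u ,
      subst₂ Incident (cong p (inject₁-edgeIndex j<len)) (cong es (sym edgeIndex-u)) p∈es-u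
      where
      edgeIndex-u : edgeIndex (toℕ u) ≡ u
      edgeIndex-u = toℕ-injective (toℕ-edgeIndex (toℕ<n u))

  leaving-right : ∀ (C : Vertex → Set) {x v} → C x → Incident x (hEdge v) → ¬ C (right v) →
                  hEdge v ≡ outEdge toRight x
  leaving-right C Cx (inj₁ x≡v) _ = cong hEdge (sym x≡v)
  leaving-right C Cx (inj₂ x≡right-v) ¬C = ⊥-elim (¬C (subst C x≡right-v Cx))

  leaving-left : ∀ (C : Vertex → Set) {x v} → C x → Incident x (hEdge v) → ¬ C v →
                 hEdge v ≡ outEdge toLeft x
  leaving-left C Cx (inj₁ x≡v) ¬C = ⊥-elim (¬C (subst C x≡v Cx))
  leaving-left C Cx (inj₂ x≡right-v) _ = cong hEdge (trans (sym (left-right _)) (cong left (sym x≡right-v)))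

  same-side-outEdges : ∀ (C : Vertex → Set) {x₁ x₂ v₁ v₂} →
    C x₁ → Incident x₁ (hEdge v₁) → C x₂ → Incident x₂ (hEdge v₂) → SameSide C (hEdge v₁) (hEdge v₂) →
    Σ Side λ d → hEdge v₁ ≡ outEdge d x₁ × hEdge v₂ ≡ outEdge d x₂
  same-side-outEdges C C₁ x₁∈ C₂ x₂∈ (inj₁ ((_ , ¬C₁) , (_ , ¬C₂))) =
    toRight , leaving-right C C₁ x₁∈ ¬C₁ , leaving-right C C₂ x₂∈ ¬C₂
  same-side-outEdges C C₁ x₁∈ C₂ x₂∈ (inj₂ ((¬C₁ , _) , (¬C₂ , _))) =
    toLeft , leaving-left C C₁ x₁∈ ¬C₁ , leaving-left C C₂ x₂∈ ¬C₂

  covered-path-reducible : ∀ {M C d x₁ x₂} → IsPerfectMatching M →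
    M (outEdge d x₁) ≡ true → M (outEdge d x₂) ≡ true → x₁ ≢ x₂ → CoveredPath M C x₁ x₂ →
    ReducibleByFlips M
  covered-path-reducible {d = d} pm x₁-out x₂-out x₁≢x₂ covered-path
    with columnPath x₁≢x₂ covered-path
  ... | len , 0<len , path with path-segment pm d x₁-out x₂-out path 0<len
  ... | x , k , segment = segment-reducible k k ℕ.≤-refl pm segment

  consecutive-reducible : ∀ M → IsPerfectMatching M → ∀ x₀ v₁ v₂ → hEdge v₁ ≢ hEdge v₂ →
    M (hEdge v₁) ≡ true → M (hEdge v₂) ≡ true →
    SameSide (ICycle x₀) (hEdge v₁) (hEdge v₂) → Consecutive M (ICycle x₀) (hEdge v₁) (hEdge v₂) →
    ReducibleByFlips M
  consecutive-reducible M pm x₀ v₁ v₂ h₁≢h₂ M₁ M₂ same-side (x₁ , x₂ , C₁ , x₁∈ , C₂ , x₂∈ , covered-path)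
    with same-side-outEdges (ICycle x₀) C₁ x₁∈ C₂ x₂∈ same-side
  ... | d , h₁≡ , h₂≡ =
    covered-path-reducible pm (subst (λ e → M e ≡ true) h₁≡ M₁) (subst (λ e → M e ≡ true) h₂≡ M₂)
      x₁≢x₂ covered-path
    where
    x₁≢x₂ : x₁ ≢ x₂
    x₁≢x₂ x₁≡x₂ = h₁≢h₂ (trans h₁≡ (trans (cong (outEdge d) x₁≡x₂) (sym h₂≡)))

lemma3p3 : (n m r : ℕ) → 1 ≤ n → 2 ≤ m → 1 ≤ r → r ≤ m →
    let open T (1 + 2 * n) (2 * m) (2 * r) in
    (M : EdgeSet) → IsPerfectMatching M →
    (x₀ : Vertex) →
    (h₁ h₂ : Edge) → h₁ ≢ h₂ →
    kind h₁ ≡ hor → kind h₂ ≡ hor →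
    M h₁ ≡ true → M h₂ ≡ true →
    SameSide (ICycle x₀) h₁ h₂ →
    Consecutive M (ICycle x₀) h₁ h₂ →
    Σ EdgeSet λ M' → Flips M M' × IsPerfectMatching M' × hcount M' + 2 ≡ hcount M
lemma3p3 n (suc m₁) r 1≤n (s≤s 1≤m₁) _ r≤m M pm x₀ (.hor , v₁) (.hor , v₂) h₁≢h₂ refl refl =
  Torus.consecutive-reducible (2 * n) (m₁ + suc (m₁ + 0)) (2 * r)
    (ℕ.≤-trans 1≤n (ℕ.m≤m+n n _)) (ℕ.≤-trans 1≤m₁ (ℕ.m≤m+n m₁ _))
    (ℕ.*-monoʳ-≤ 2 r≤m) (divides (suc m₁) (ℕ.*-comm 2 (suc m₁))) (divides r (ℕ.*-comm 2 r))
    M pm x₀ v₁ v₂ h₁≢h₂
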